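{- Let $M$ be an $m\times n$ matrix over a field, let $k\in\mathbb{N}$, and let $r_1,\dots,r_{k+1}\in\{1,\dots,m\}$ and $c_1,\dots,c_k\in\{1,\dots,n\}$ (with the $r_i$ also regarded as column indices, so that the minors below are defined). Then the determinant of the $k\times k$ matrix whose $(i,j)$ entry is $$M\big(\begin{smallmatrix} r_i&r_{i+1}&\dots&r_{k+1}\\ c_j&r_{i+1}&\dots&r_{k+1}\end{smallmatrix}\big)\qquad (1\le i,j\le k)$$ equals $$M\big(\begin{smallmatrix} r_1&r_2&\dots&r_k&r_{k+1}\\ c_1&c_2&\dots&c_k&r_{k+1}\end{smallmatrix}\big)\,M\big(\begin{smallmatrix} r_2&\dots&r_{k+1}\\ r_2&\dots&r_{k+1}\end{smallmatrix}\big)\,M\big(\begin{smallmatrix} r_3&\dots&r_{k+1}\\ r_3&\dots&r_{k+1}\end{smallmatrix}\big)\cdots M\big(\begin{smallmatrix} r_k&r_{k+1}\\ r_k&r_{k+1}\end{smallmatrix}\big).$$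
   Context: For a matrix $M$, the minor $M\big(\begin{smallmatrix} r_1&\dots&r_k\\ c_1&\dots&c_k\end{smallmatrix}\big)$ is the determinant of the $k\times k$ matrix $(M_{r_i c_j})_{i,j=1}^k$. The empty minor is $1$; for $k=1$ the product of principal-type minors on the right is empty (equal to $1$). -}

module Defs where

open import Level using (Level; _⊔_)
open import Data.Nat using (ℕ; zero; suc; _∸_; _<_)
open import Data.Fin using (Fin; zero; suc; toℕ; inject₁; fromℕ<)
open import Data.Product using (∃)
open import Relation.Nullary using (¬_)
open import Algebra.Bundles using (CommutativeRing)

record IsField {c ℓ : Level} (R : CommutativeRing c ℓ) : Set (c ⊔ ℓ) where
  open CommutativeRing R
  field
    1≉0     : ¬ (1# ≈ 0#)
    inverse : ∀ x → ¬ (x ≈ 0#) → ∃ λ y → x * y ≈ 1#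

cons : {a : Level} {A : Set a} {s : ℕ} → A → (Fin s → A) → Fin (suc s) → A
cons a f zero    = a
cons a f (suc t) = f t

snoc : {a : Level} {A : Set a} {s : ℕ} → (Fin s → A) → A → Fin (suc s) → A
snoc {s = zero}  f a zero    = a
snoc {s = suc s} f a zero    = f zero
snoc {s = suc s} f a (suc t) = snoc (λ u → f (suc u)) a t

-- idx p t = p + t : the positions p, p+1, ..., K of Fin (suc K)
-- (the suffix starting at position p has length suc K ∸ p).
idx : {K : ℕ} (p : Fin (suc K)) → Fin (suc K ∸ toℕ p) → Fin (suc K)
idx zero t = t
idx {suc K} (suc p) t = suc (idx {K} p t)

module _ {c ℓ : Level} (R : CommutativeRing c ℓ) where
  open CommutativeRing R using (Carrier; _+_; _*_; -_; 0#; 1#)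

  ∑ : (s : ℕ) → (Fin s → Carrier) → Carrier
  ∑ zero    f = 0#
  ∑ (suc s) f = f zero + ∑ s (λ i → f (suc i))

  ∏ : (s : ℕ) → (Fin s → Carrier) → Carrier
  ∏ zero    f = 1#
  ∏ (suc s) f = f zero * ∏ s (λ i → f (suc i))

  sgn : {s : ℕ} → Fin s → Carrier
  sgn zero    = 1#
  sgn (suc j) = - sgn j

  det : (s : ℕ) → (Fin s → Fin s → Carrier) → Carrier
  det zero    A = 1#
  det (suc s) A = ∑ (suc s) λ j →
    sgn j * (A zero j * det s (λ a b → A (suc a) (Data.Fin.punchIn j b)))

  minor : {m n : ℕ} → (Fin m → Fin n → Carrier) →
          (s : ℕ) → (Fin s → Fin m) → (Fin s → Fin n) → Carrier
  minor M s rows cols = det s (λ a b → M (rows a) (cols b))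

-- The identity holds over any commutative ring, and the column
-- indices rc of the rows r need not be related to r; it is proved in that generality.
--
-- Induction on k, with R = r₂ … r_{k+1} and p = r_{k+1}.  Expanding the left-hand determinant along
-- its first row, the induction hypothesis evaluates the cofactor of column j as M(R; c∖cⱼ, p) times
-- the right-hand product without its first two factors, so the step is the bordered expansion
--   Σⱼ (-1)ʲ M(r₁ R; cⱼ R) · M(R; c∖cⱼ, p) = M(r₁ R; c, p) · M(R; R).
-- Expanding M(r₁ R; w R) along its first row writes it as M_{r₁w} · M(R; R) plus a combination of
-- the minors ψₛ(w) of M(R; ·) in which column s is replaced by w.  As ψₛ is a linear combination of
-- the rows of M(R; ·), the determinant with first row ψₛ and further rows M(R; c, p) vanishes;
-- splitting off its last column trades the sums over j for terms in ψₛ(p), and these add up to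
-- M_{r₁p} · M(R; R) because M(r₁ R; p R) = 0 (its first and last columns coincide).

module Submission where

open import Defs
open import Level using (Level)
open import Data.Nat using (ℕ; zero; suc; _∸_; _<_)
open import Data.Fin using (Fin; zero; suc; toℕ; inject₁; fromℕ<; fromℕ; punchIn)
open import Data.Product using (Σ; _,_; proj₁; proj₂)
open import Function using (_∘_)
open import Algebra.Bundles using (CommutativeRing)
open import Relation.Binary.PropositionalEquality as ≡ using (_≡_; _≗_)
import Algebra.Properties.CommutativeSemigroup as CommutativeSemigroupProperties
import Algebra.Properties.Ring as RingProperties
import Algebra.Properties.Semiring.Sum as SemiringSum
import Algebra.Solver.Ring.NaturalCoefficients.Default as NaturalCoefficients
import Relation.Binary.Reasoning.Setoid as SetoidReasoning

punchIn-fromℕ : ∀ {N} (b : Fin N) → punchIn (fromℕ N) b ≡ inject₁ b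
punchIn-fromℕ zero    = ≡.refl
punchIn-fromℕ (suc b) = ≡.cong suc (punchIn-fromℕ b)

punchIn-inject₁-fromℕ : ∀ {N} (j : Fin (suc N)) → punchIn (inject₁ j) (fromℕ N) ≡ fromℕ (suc N)
punchIn-inject₁-fromℕ         zero    = ≡.refl
punchIn-inject₁-fromℕ {suc N} (suc j) = ≡.cong suc (punchIn-inject₁-fromℕ j)

punchIn-inject₁-inject₁ : ∀ {N} (j : Fin (suc N)) (b : Fin N) →
                          punchIn (inject₁ j) (inject₁ b) ≡ inject₁ (punchIn j b)
punchIn-inject₁-inject₁ zero    b       = ≡.refl
punchIn-inject₁-inject₁ (suc j) zero    = ≡.refl
punchIn-inject₁-inject₁ (suc j) (suc b) = ≡.cong suc (punchIn-inject₁-inject₁ j b)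

rotate : ∀ {N} → Fin (suc N) → Fin (suc N)
rotate {N} = cons (fromℕ N) inject₁

rotate-punchIn : ∀ {N} (j b : Fin (suc N)) → rotate (punchIn (suc j) b) ≡ punchIn (inject₁ j) (rotate b)
rotate-punchIn j zero    = ≡.sym (punchIn-inject₁-fromℕ j)
rotate-punchIn j (suc b) = ≡.sym (punchIn-inject₁-inject₁ j b)

module _ {a} {A : Set a} where

  snoc-inject₁ : ∀ {N} (f : Fin N → A) x (j : Fin N) → snoc f x (inject₁ j) ≡ f j
  snoc-inject₁ {suc N} f x zero    = ≡.refl
  snoc-inject₁ {suc N} f x (suc j) = snoc-inject₁ (f ∘ suc) x j

  snoc-fromℕ : ∀ {N} (f : Fin N → A) x → snoc f x (fromℕ N) ≡ x
  snoc-fromℕ {zero}  f x = ≡.refl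
  snoc-fromℕ {suc N} f x = snoc-fromℕ (f ∘ suc) x

  snoc-punchIn-inject₁ : ∀ {N} (f : Fin (suc N) → A) x (j b : Fin (suc N)) →
                         snoc f x (punchIn (inject₁ j) b) ≡ snoc (f ∘ punchIn j) x b
  snoc-punchIn-inject₁         f x zero    b       = ≡.refl
  snoc-punchIn-inject₁ {suc N} f x (suc j) zero    = ≡.refl
  snoc-punchIn-inject₁ {suc N} f x (suc j) (suc b) = snoc-punchIn-inject₁ (f ∘ suc) x j b

module Determinant {c ℓ : Level} (R : CommutativeRing c ℓ) where
  open CommutativeRing R hiding (zero)
  open RingProperties ring
    using (-‿distribˡ-*; -‿distribʳ-*; -‿involutive; -1*x≈-x; +-inverseˡ-unique; +-inverseʳ-unique)
  private module Lib = SemiringSum semiring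
  open Lib using (sum)
  open NaturalCoefficients commutativeSemiring using (solve; _:+_; _:*_; _:=_)
  open CommutativeSemigroupProperties *-commutativeSemigroup using (x∙yz≈y∙xz)
  open SetoidReasoning setoid

  Matrix : ℕ → ℕ → Set c
  Matrix s t = Fin s → Fin t → Carrier

  -- Finite sums

  ∑≈sum : ∀ {s} (f : Fin s → Carrier) → ∑ R s f ≈ sum f
  ∑≈sum {zero}  f = refl
  ∑≈sum {suc s} f = +-congˡ (∑≈sum (f ∘ suc))

  ∑-cong : ∀ {s} {f g : Fin s → Carrier} → (∀ i → f i ≈ g i) → ∑ R s f ≈ ∑ R s g
  ∑-cong {f = f} {g} f≈g = begin
    ∑ R _ f  ≈⟨ ∑≈sum f ⟩
    sum f    ≈⟨ Lib.sum-cong-≋ f≈g ⟩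
    sum g    ≈⟨ ∑≈sum g ⟨
    ∑ R _ g  ∎

  ∑-zero : ∀ {s} {f : Fin s → Carrier} → (∀ i → f i ≈ 0#) → ∑ R s f ≈ 0#
  ∑-zero {s} f≈0 = trans (∑-cong f≈0) (trans (∑≈sum {s} (λ _ → 0#)) (Lib.sum-replicate-zero s))

  ∑-distrib-+ : ∀ {s} (f g : Fin s → Carrier) → ∑ R s (λ i → f i + g i) ≈ ∑ R s f + ∑ R s g
  ∑-distrib-+ f g = begin
    ∑ R _ (λ i → f i + g i)  ≈⟨ ∑≈sum (λ i → f i + g i) ⟩
    sum (λ i → f i + g i)    ≈⟨ Lib.∑-distrib-+ f g ⟩
    sum f + sum g            ≈⟨ +-cong (∑≈sum f) (∑≈sum g) ⟨
    ∑ R _ f + ∑ R _ g        ∎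

  *-distribˡ-∑ : ∀ {s} x (f : Fin s → Carrier) → x * ∑ R s f ≈ ∑ R s (λ i → x * f i)
  *-distribˡ-∑ x f = begin
    x * ∑ R _ f              ≈⟨ *-congˡ (∑≈sum f) ⟩
    x * sum f                ≈⟨ Lib.*-distribˡ-sum x f ⟩
    sum (λ i → x * f i)      ≈⟨ ∑≈sum (λ i → x * f i) ⟨
    ∑ R _ (λ i → x * f i)    ∎

  *-distribʳ-∑ : ∀ {s} x (f : Fin s → Carrier) → ∑ R s f * x ≈ ∑ R s (λ i → f i * x)
  *-distribʳ-∑ x f = begin
    ∑ R _ f * x              ≈⟨ *-congʳ (∑≈sum f) ⟩
    sum f * x                ≈⟨ Lib.*-distribʳ-sum x f ⟩
    sum (λ i → f i * x)      ≈⟨ ∑≈sum (λ i → f i * x) ⟨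
    ∑ R _ (λ i → f i * x)    ∎

  -‿distrib-∑ : ∀ {s} (f : Fin s → Carrier) → - ∑ R s f ≈ ∑ R s (λ i → - f i)
  -‿distrib-∑ f = begin
    - ∑ R _ f                ≈⟨ -1*x≈-x _ ⟨
    - 1# * ∑ R _ f           ≈⟨ *-distribˡ-∑ (- 1#) f ⟩
    ∑ R _ (λ i → - 1# * f i) ≈⟨ ∑-cong (λ i → -1*x≈-x (f i)) ⟩
    ∑ R _ (λ i → - f i)      ∎

  ∑-comm : ∀ {s t} (f : Fin s → Fin t → Carrier) →
           ∑ R s (λ i → ∑ R t (f i)) ≈ ∑ R t (λ j → ∑ R s (λ i → f i j))
  ∑-comm f = begin
    ∑ R _ (λ i → ∑ R _ (f i))
      ≈⟨ trans (∑-cong (λ i → ∑≈sum (f i))) (∑≈sum (λ i → sum (f i))) ⟩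
    sum (λ i → sum (f i))
      ≈⟨ Lib.∑-comm f ⟩
    sum (λ j → sum (λ i → f i j))
      ≈⟨ trans (∑-cong (λ j → ∑≈sum (λ i → f i j))) (∑≈sum (λ j → sum (λ i → f i j))) ⟨
    ∑ R _ (λ j → ∑ R _ (λ i → f i j)) ∎

  ∑-*-∑-swap : ∀ {s t} (a : Fin s → Carrier) (x : Fin t → Carrier) (y : Fin s → Fin t → Carrier) →
               ∑ R s (λ j → a j * ∑ R t (λ i → x i * y j i)) ≈ ∑ R t (λ i → x i * ∑ R s (λ j → a j * y j i))
  ∑-*-∑-swap a x y = begin
    ∑ R _ (λ j → a j * ∑ R _ (λ i → x i * y j i))
      ≈⟨ ∑-cong (λ j → *-distribˡ-∑ (a j) (λ i → x i * y j i)) ⟩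
    ∑ R _ (λ j → ∑ R _ (λ i → a j * (x i * y j i)))
      ≈⟨ ∑-comm (λ j i → a j * (x i * y j i)) ⟩
    ∑ R _ (λ i → ∑ R _ (λ j → a j * (x i * y j i)))
      ≈⟨ ∑-cong (λ i → ∑-cong (λ j → x∙yz≈y∙xz (a j) (x i) (y j i))) ⟩
    ∑ R _ (λ i → ∑ R _ (λ j → x i * (a j * y j i)))
      ≈⟨ ∑-cong (λ i → *-distribˡ-∑ (x i) (λ j → a j * y j i)) ⟨
    ∑ R _ (λ i → x i * ∑ R _ (λ j → a j * y j i)) ∎

  ∑∑-split : ∀ {n} (T : Fin (suc (suc n)) → Fin (suc n) → Carrier) →
             ∑ R (suc (suc n)) (λ j → ∑ R (suc n) (T j)) ≈
             ∑ R (suc n) (λ k → T zero k + T (suc k) zero) + ∑ R (suc n) (λ j → ∑ R n (λ k → T (suc j) (suc k)))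
  ∑∑-split T = begin
    ∑ R _ (T zero) + ∑ R _ (λ j → T (suc j) zero + ∑ R _ (λ k → T (suc j) (suc k)))
      ≈⟨ +-congˡ (∑-distrib-+ (λ j → T (suc j) zero) (λ j → ∑ R _ (λ k → T (suc j) (suc k)))) ⟩
    ∑ R _ (T zero) + (∑ R _ (λ j → T (suc j) zero) + ∑ R _ (λ j → ∑ R _ (λ k → T (suc j) (suc k))))
      ≈⟨ +-assoc _ _ _ ⟨
    ∑ R _ (T zero) + ∑ R _ (λ j → T (suc j) zero) + ∑ R _ (λ j → ∑ R _ (λ k → T (suc j) (suc k)))
      ≈⟨ +-congʳ (∑-distrib-+ (T zero) (λ k → T (suc k) zero)) ⟨
    ∑ R _ (λ k → T zero k + T (suc k) zero) + ∑ R _ (λ j → ∑ R _ (λ k → T (suc j) (suc k))) ∎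

  ∑-init-last : ∀ {s} (f : Fin (suc s) → Carrier) → ∑ R (suc s) f ≈ ∑ R s (f ∘ inject₁) + f (fromℕ s)
  ∑-init-last f = begin
    ∑ R _ f                            ≈⟨ ∑≈sum f ⟩
    sum f                              ≈⟨ Lib.sum-init-last f ⟩
    sum (f ∘ inject₁) + f (fromℕ _)    ≈⟨ +-congʳ (∑≈sum (f ∘ inject₁)) ⟨
    ∑ R _ (f ∘ inject₁) + f (fromℕ _)  ∎

  -x*-y≈x*y : ∀ x y → - x * - y ≈ x * y
  -x*-y≈x*y x y = begin
    - x * - y      ≈⟨ -‿distribˡ-* x (- y) ⟨
    - (x * - y)    ≈⟨ -‿cong (-‿distribʳ-* x y) ⟨
    - - (x * y)    ≈⟨ -‿involutive (x * y) ⟩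
    x * y          ∎

  -x*[-y*z]≈x*[y*z] : ∀ x y z → - x * (- y * z) ≈ x * (y * z)
  -x*[-y*z]≈x*[y*z] x y z = trans (*-congˡ (sym (-‿distribˡ-* y z))) (-x*-y≈x*y x (y * z))

  x*[y*z]≈0 : ∀ x y {z} → z ≈ 0# → x * (y * z) ≈ 0#
  x*[y*z]≈0 x y z≈0 = trans (*-congˡ (trans (*-congˡ z≈0) (zeroʳ y))) (zeroʳ x)

  sgn-inject₁ : ∀ {s} (j : Fin s) → sgn R (inject₁ j) ≡ sgn R j
  sgn-inject₁ zero    = ≡.refl
  sgn-inject₁ (suc j) = ≡.cong -_ (sgn-inject₁ j)

  sgn*sgn≈1 : ∀ {s} (j : Fin s) → sgn R j * sgn R j ≈ 1#
  sgn*sgn≈1 zero    = *-identityˡ 1#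
  sgn*sgn≈1 (suc j) = trans (-x*-y≈x*y _ _) (sgn*sgn≈1 j)

  det-cong : ∀ {s} {A B : Matrix s s} → (∀ a b → A a b ≈ B a b) → det R s A ≈ det R s B
  det-cong {zero}  _   = refl
  det-cong {suc s} A≈B =
    ∑-cong λ j → *-congˡ {sgn R j} (*-cong (A≈B zero j) (det-cong λ a b → A≈B (suc a) (punchIn j b)))

  detCols : ∀ {s t} → Matrix s t → (Fin s → Fin t) → Carrier
  detCols {s} Q f = det R s (λ a b → Q a (f b))

  detCols-cong : ∀ {s t} (Q : Matrix s t) {f g : Fin s → Fin t} → f ≗ g → detCols Q f ≈ detCols Q g
  detCols-cong Q f≗g = det-cong λ a b → reflexive (≡.cong (Q a) (f≗g b))

  -- Alternation in the rows

  -- A term of the expansion along two rows: (j , punchIn j k) runs over the ordered pairs of distinct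
  -- columns, S weighs the pair and G the remaining columns.
  pairTerm : ∀ {n} → Matrix (suc (suc n)) (suc (suc n)) → ((Fin n → Fin (suc (suc n))) → Carrier) →
             Fin (suc (suc n)) → Fin (suc n) → Carrier
  pairTerm S G j k = sgn R j * (sgn R k * (S j (punchIn j k) * G (punchIn j ∘ punchIn k)))

  pairTerm-cancel : ∀ {n} (S : Matrix (suc (suc n)) (suc (suc n))) → (∀ j l → S j l ≈ S l j) →
                    (G : (Fin n → Fin (suc (suc n))) → Carrier) →
                    ∀ k → pairTerm S G zero k + pairTerm S G (suc k) zero ≈ 0#
  pairTerm-cancel S S-sym G k = begin
    1# * (sgn R k * (S zero (suc k) * g)) + - sgn R k * (1# * (S (suc k) zero * g))
      ≈⟨ +-cong (*-identityˡ _) (*-congˡ (*-identityˡ _)) ⟩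
    sgn R k * (S zero (suc k) * g) + - sgn R k * (S (suc k) zero * g)
      ≈⟨ +-congˡ (*-congˡ (*-congʳ (S-sym (suc k) zero))) ⟩
    sgn R k * (S zero (suc k) * g) + - sgn R k * (S zero (suc k) * g)
      ≈⟨ +-congˡ (-‿distribˡ-* _ _) ⟨
    sgn R k * (S zero (suc k) * g) + - (sgn R k * (S zero (suc k) * g))
      ≈⟨ -‿inverseʳ _ ⟩
    0# ∎
    where g = G (suc ∘ punchIn k)

  pairTerm-shift : ∀ {n} (S : Matrix (suc (suc (suc n))) (suc (suc (suc n))))
                   (G : (Fin (suc n) → Fin (suc (suc (suc n)))) → Carrier) → (∀ {f g} → f ≗ g → G f ≈ G g) →
                   ∀ j k → pairTerm S G (suc j) (suc k) ≈
                           pairTerm (λ a b → S (suc a) (suc b)) (λ f → G (cons zero (suc ∘ f))) j k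
  pairTerm-shift S G G-resp j k = trans (-x*[-y*z]≈x*[y*z] _ _ _)
    (*-congˡ (*-congˡ (*-congˡ (G-resp λ { zero → ≡.refl ; (suc x) → ≡.refl }))))

  ∑-pairTerm≈0 : ∀ {n} (S : Matrix (suc (suc n)) (suc (suc n))) → (∀ j l → S j l ≈ S l j) →
                 (G : (Fin n → Fin (suc (suc n))) → Carrier) → (∀ {f g} → f ≗ g → G f ≈ G g) →
                 ∑ R (suc (suc n)) (λ j → ∑ R (suc n) (pairTerm S G j)) ≈ 0#
  ∑-pairTerm-tail≈0 : ∀ {n} (S : Matrix (suc (suc n)) (suc (suc n))) → (∀ j l → S j l ≈ S l j) →
                      (G : (Fin n → Fin (suc (suc n))) → Carrier) → (∀ {f g} → f ≗ g → G f ≈ G g) →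
                      ∑ R (suc n) (λ j → ∑ R n (λ k → pairTerm S G (suc j) (suc k))) ≈ 0#

  ∑-pairTerm≈0 S S-sym G G-resp = begin
    ∑ R _ (λ j → ∑ R _ (pairTerm S G j))
      ≈⟨ ∑∑-split (pairTerm S G) ⟩
    ∑ R _ (λ k → pairTerm S G zero k + pairTerm S G (suc k) zero)
    + ∑ R _ (λ j → ∑ R _ (λ k → pairTerm S G (suc j) (suc k)))
      ≈⟨ +-cong (∑-zero (pairTerm-cancel S S-sym G)) (∑-pairTerm-tail≈0 S S-sym G G-resp) ⟩
    0# + 0#
      ≈⟨ +-identityʳ 0# ⟩
    0# ∎

  ∑-pairTerm-tail≈0 {zero}  _ _     _ _      = +-identityʳ 0#
  ∑-pairTerm-tail≈0 {suc n} S S-sym G G-resp =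
    trans (∑-cong λ j → ∑-cong (pairTerm-shift S G G-resp j))
          (∑-pairTerm≈0 (λ a b → S (suc a) (suc b)) (λ a b → S-sym (suc a) (suc b))
                        (λ f → G (cons zero (suc ∘ f)))
                        (λ f≗g → G-resp λ { zero → ≡.refl ; (suc x) → ≡.cong suc (f≗g x) }))

  det-expand-two-rows : ∀ {s} (u v : Fin (suc (suc s)) → Carrier) (Q : Matrix s (suc (suc s))) →
    det R (suc (suc s)) (cons u (cons v Q)) ≈
    ∑ R (suc (suc s)) (λ j → ∑ R (suc s) (pairTerm (λ a b → u a * v b) (detCols Q) j))
  det-expand-two-rows u v Q = ∑-cong λ j → begin
    sgn R j * (u j * ∑ R _ (λ k → sgn R k * (v (punchIn j k) * m j k)))
      ≈⟨ *-congˡ (*-distribˡ-∑ (u j) (λ k → sgn R k * (v (punchIn j k) * m j k))) ⟩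
    sgn R j * ∑ R _ (λ k → u j * (sgn R k * (v (punchIn j k) * m j k)))
      ≈⟨ *-distribˡ-∑ (sgn R j) (λ k → u j * (sgn R k * (v (punchIn j k) * m j k))) ⟩
    ∑ R _ (λ k → sgn R j * (u j * (sgn R k * (v (punchIn j k) * m j k))))
      ≈⟨ ∑-cong (λ k → regroup (sgn R j) (sgn R k) (u j) (v (punchIn j k)) (m j k)) ⟩
    ∑ R _ (pairTerm (λ a b → u a * v b) (detCols Q) j) ∎
    where
    m : ∀ j k → Carrier
    m j k = detCols Q (punchIn j ∘ punchIn k)
    regroup : ∀ a b x y z → a * (x * (b * (y * z))) ≈ a * (b * ((x * y) * z))
    regroup = solve 5 (λ a b x y z → a :* (x :* (b :* (y :* z))) := a :* (b :* ((x :* y) :* z))) refl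

  det-equal-first-rows≈0 : ∀ {s} (u : Fin (suc (suc s)) → Carrier) (Q : Matrix s (suc (suc s))) →
                           det R (suc (suc s)) (cons u (cons u Q)) ≈ 0#
  det-equal-first-rows≈0 u Q = trans (det-expand-two-rows u u Q)
    (∑-pairTerm≈0 (λ a b → u a * u b) (λ j l → *-comm (u j) (u l)) (detCols Q) (detCols-cong Q))

  det-swap-first-rows : ∀ {s} (u v : Fin (suc (suc s)) → Carrier) (Q : Matrix s (suc (suc s))) →
                        det R (suc (suc s)) (cons u (cons v Q)) + det R (suc (suc s)) (cons v (cons u Q)) ≈ 0#
  det-swap-first-rows u v Q = begin
    det R _ (cons u (cons v Q)) + det R _ (cons v (cons u Q))
      ≈⟨ +-cong (det-expand-two-rows u v Q) (det-expand-two-rows v u Q) ⟩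
    ∑ R _ (λ j → ∑ R _ (pairTerm Suv G j)) + ∑ R _ (λ j → ∑ R _ (pairTerm Svu G j))
      ≈⟨ ∑-distrib-+ (λ j → ∑ R _ (pairTerm Suv G j)) (λ j → ∑ R _ (pairTerm Svu G j)) ⟨
    ∑ R _ (λ j → ∑ R _ (pairTerm Suv G j) + ∑ R _ (pairTerm Svu G j))
      ≈⟨ ∑-cong (λ j → trans (sym (∑-distrib-+ (pairTerm Suv G j) (pairTerm Svu G j))) (∑-cong (pairTerm-+ j))) ⟩
    ∑ R _ (λ j → ∑ R _ (pairTerm (λ a b → Suv a b + Svu a b) G j))
      ≈⟨ ∑-pairTerm≈0 (λ a b → Suv a b + Svu a b) (λ j l → trans (+-comm _ _) (+-cong (*-comm _ _) (*-comm _ _)))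
                      G (detCols-cong Q) ⟩
    0# ∎
    where
    Suv : Matrix (suc (suc _)) (suc (suc _))
    Suv a b = u a * v b
    Svu : Matrix (suc (suc _)) (suc (suc _))
    Svu a b = v a * u b
    G = detCols Q
    pairTerm-+ : ∀ j k → pairTerm Suv G j k + pairTerm Svu G j k ≈ pairTerm (λ a b → Suv a b + Svu a b) G j k
    pairTerm-+ j k =
      solve 5 (λ a b x y z → a :* (b :* (x :* z)) :+ a :* (b :* (y :* z)) := a :* (b :* ((x :+ y) :* z))) refl
      (sgn R j) (sgn R k) (Suv j (punchIn j k)) (Svu j (punchIn j k)) (G (punchIn j ∘ punchIn k))

  det-repeated-row≈0 : ∀ {s} (Q : Matrix (suc s) (suc (suc s))) t → det R (suc (suc s)) (cons (Q t) Q) ≈ 0#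
  det-repeated-row≈0 Q zero = trans
    (det-cong {A = cons (Q zero) Q} {B = cons (Q zero) (cons (Q zero) (Q ∘ suc))}
              λ { zero b → refl ; (suc zero) b → refl ; (suc (suc a)) b → refl })
    (det-equal-first-rows≈0 (Q zero) (Q ∘ suc))
  det-repeated-row≈0 {suc s} Q (suc t) = begin
    det R (suc (suc (suc s))) (cons (Q (suc t)) Q)
      ≈⟨ det-cong {A = cons (Q (suc t)) Q} {B = cons u (cons v Q′)}
                  (λ { zero b → refl ; (suc zero) b → refl ; (suc (suc a)) b → refl }) ⟩
    det R (suc (suc (suc s))) (cons u (cons v Q′))
      ≈⟨ +-identityʳ _ ⟨
    det R (suc (suc (suc s))) (cons u (cons v Q′)) + 0#
      ≈⟨ +-congˡ (∑-zero λ j → x*[y*z]≈0 (sgn R j) (v j) (cofactor≈0 j)) ⟨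
    det R (suc (suc (suc s))) (cons u (cons v Q′)) + det R (suc (suc (suc s))) (cons v (cons u Q′))
      ≈⟨ det-swap-first-rows u v Q′ ⟩
    0# ∎
    where
    u = Q (suc t)
    v = Q zero
    Q′ = Q ∘ suc
    cofactor≈0 : ∀ j → det R _ (λ a b → cons u Q′ a (punchIn j b)) ≈ 0#
    cofactor≈0 j = trans (det-cong {A = λ a b → cons u Q′ a (punchIn j b)}
                                   {B = cons (u ∘ punchIn j) (λ a b → Q′ a (punchIn j b))}
                                   λ { zero b → refl ; (suc a) b → refl })
                         (det-repeated-row≈0 (λ a b → Q′ a (punchIn j b)) t)

  det-linear-firstRow : ∀ {s T} (W : Matrix T (suc s)) (μ : Fin T → Carrier)
                        (u : Fin (suc s) → Carrier) (Q : Matrix s (suc s)) →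
                        (∀ b → u b ≈ ∑ R T (λ t → W t b * μ t)) →
                        det R (suc s) (cons u Q) ≈ ∑ R T (λ t → det R (suc s) (cons (W t) Q) * μ t)
  det-linear-firstRow W μ u Q u≈Wμ = begin
    ∑ R _ (λ j → sgn R j * (u j * m j))
      ≈⟨ ∑-cong (λ j → *-congˡ {sgn R j} (*-congʳ {m j} (u≈Wμ j))) ⟩
    ∑ R _ (λ j → sgn R j * (∑ R _ (λ t → W t j * μ t) * m j))
      ≈⟨ ∑-cong distribute ⟩
    ∑ R _ (λ j → ∑ R _ (λ t → sgn R j * (W t j * m j) * μ t))
      ≈⟨ ∑-comm (λ j t → sgn R j * (W t j * m j) * μ t) ⟩
    ∑ R _ (λ t → ∑ R _ (λ j → sgn R j * (W t j * m j) * μ t))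
      ≈⟨ ∑-cong (λ t → *-distribʳ-∑ (μ t) (λ j → sgn R j * (W t j * m j))) ⟨
    ∑ R _ (λ t → det R _ (cons (W t) Q) * μ t) ∎
    where
    m = detCols Q ∘ punchIn
    distribute : ∀ j → sgn R j * (∑ R _ (λ t → W t j * μ t) * m j) ≈ ∑ R _ (λ t → sgn R j * (W t j * m j) * μ t)
    distribute j = begin
      sgn R j * (∑ R _ (λ t → W t j * μ t) * m j)  ≈⟨ *-congˡ (*-distribʳ-∑ (m j) (λ t → W t j * μ t)) ⟩
      sgn R j * ∑ R _ (λ t → W t j * μ t * m j)    ≈⟨ *-distribˡ-∑ (sgn R j) (λ t → W t j * μ t * m j) ⟩
      ∑ R _ (λ t → sgn R j * (W t j * μ t * m j))  ≈⟨ ∑-cong (λ t → regroup (sgn R j) (W t j) (μ t) (m j)) ⟩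
      ∑ R _ (λ t → sgn R j * (W t j * m j) * μ t)  ∎
      where
      regroup : ∀ a w x y → a * (w * x * y) ≈ a * (w * y) * x
      regroup = solve 4 (λ a w x y → a :* (w :* x :* y) := a :* (w :* y) :* x) refl

  det-firstRow-in-rowSpan≈0 : ∀ {s} (Q : Matrix (suc s) (suc (suc s))) (μ : Fin (suc s) → Carrier)
                              (u : Fin (suc (suc s)) → Carrier) →
                              (∀ b → u b ≈ ∑ R (suc s) (λ t → Q t b * μ t)) →
                              det R (suc (suc s)) (cons u Q) ≈ 0#
  det-firstRow-in-rowSpan≈0 Q μ u u≈Qμ = trans (det-linear-firstRow Q μ u Q u≈Qμ)
    (∑-zero λ t → trans (*-congʳ (det-repeated-row≈0 Q t)) (zeroˡ (μ t)))

  -- Expansion along the first column and alternation in the columns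

  firstColumn-cofactors : ∀ {s} (Z : Matrix (suc s) s) → Σ (Fin (suc s) → Carrier) λ μ →
    ∀ (v : Fin (suc s) → Carrier) → det R (suc s) (λ a → cons (v a) (Z a)) ≈ ∑ R (suc s) (λ t → v t * μ t)
  firstColumn-cofactors {zero}  Z = (λ _ → 1#) , λ v → +-congʳ (*-identityˡ (v zero * 1#))
  firstColumn-cofactors {suc s} Z = μ , expand
    where
    cofactorsOf : ∀ j → Fin (suc s) → Carrier
    cofactorsOf j = proj₁ (firstColumn-cofactors (λ a b → Z (suc a) (punchIn j b)))
    μ : Fin (suc (suc s)) → Carrier
    μ zero    = det R (suc s) (Z ∘ suc)
    μ (suc t) = ∑ R (suc s) (λ j → - sgn R j * Z zero j * cofactorsOf j t)
    minor-expansion : ∀ v j →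
      - sgn R j * (Z zero j * det R (suc s) (λ a b → cons (v (suc a)) (Z (suc a)) (punchIn (suc j) b)))
      ≈ - sgn R j * Z zero j * ∑ R (suc s) (λ t → v (suc t) * cofactorsOf j t)
    minor-expansion v j = trans (sym (*-assoc _ _ _)) (*-congˡ (trans
      (det-cong {A = λ a b → cons (v (suc a)) (Z (suc a)) (punchIn (suc j) b)}
                {B = λ a → cons (v (suc a)) (λ b → Z (suc a) (punchIn j b))} λ { a zero → refl ; a (suc b) → refl })
      (proj₂ (firstColumn-cofactors (λ a b → Z (suc a) (punchIn j b))) (v ∘ suc))))
    expand : ∀ v → det R (suc (suc s)) (λ a → cons (v a) (Z a)) ≈ ∑ R (suc (suc s)) (λ t → v t * μ t)
    expand v = +-cong (*-identityˡ (v zero * μ zero)) (trans (∑-cong (minor-expansion v))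
      (∑-*-∑-swap (λ j → - sgn R j * Z zero j) (v ∘ suc) cofactorsOf))

  det-equal-first-columns≈0 : ∀ {s} (A : Matrix (suc (suc s)) (suc (suc s))) →
                              (∀ a → A a zero ≈ A a (suc zero)) → det R (suc (suc s)) A ≈ 0#
  later-cofactor≈0 : ∀ {s} (A : Matrix (suc (suc s)) (suc (suc s))) →
                     (∀ a → A a zero ≈ A a (suc zero)) → (j : Fin s) →
                     detCols (A ∘ suc) (punchIn (suc (suc j))) ≈ 0#

  det-equal-first-columns≈0 A A₀≈A₁ = begin
    t₀ + (t₁ + rest)  ≈⟨ +-assoc t₀ t₁ rest ⟨
    t₀ + t₁ + rest    ≈⟨ +-cong first-two-cancel (∑-zero λ j → x*[y*z]≈0 _ _ (later-cofactor≈0 A A₀≈A₁ j)) ⟩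
    0# + 0#           ≈⟨ +-identityʳ 0# ⟩
    0#                ∎
    where
    m = detCols (A ∘ suc) ∘ punchIn
    t₀ = 1# * (A zero zero * m zero)
    t₁ = - 1# * (A zero (suc zero) * m (suc zero))
    rest = ∑ R _ (λ j → sgn R (suc (suc j)) * (A zero (suc (suc j)) * m (suc (suc j))))
    m₀≈m₁ : m zero ≈ m (suc zero)
    m₀≈m₁ = det-cong {A = λ a b → A (suc a) (suc b)} {B = λ a b → A (suc a) (punchIn (suc zero) b)}
                     λ { a zero → sym (A₀≈A₁ (suc a)) ; a (suc b) → refl }
    first-two-cancel : t₀ + t₁ ≈ 0#
    first-two-cancel = begin
      t₀ + t₁                                           ≈⟨ +-congˡ (-‿distribˡ-* _ _) ⟨
      t₀ + - (1# * (A zero (suc zero) * m (suc zero)))  ≈⟨ +-congˡ (-‿cong (*-congˡ (*-cong (A₀≈A₁ zero) m₀≈m₁))) ⟨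
      t₀ + - t₀                                         ≈⟨ -‿inverseʳ t₀ ⟩
      0#                                                ∎

  later-cofactor≈0 {suc s} A A₀≈A₁ j =
    det-equal-first-columns≈0 (λ a b → A (suc a) (punchIn (suc (suc j)) b)) (A₀≈A₁ ∘ suc)

  det-expand-last-column : ∀ {N} (A : Matrix (suc (suc N)) (suc (suc N))) →
    det R (suc (suc N)) A ≈
      ∑ R (suc N) (λ j → sgn R j * (A zero (inject₁ j) * detCols (A ∘ suc) (punchIn (inject₁ j))))
      + sgn R (fromℕ (suc N)) * (A zero (fromℕ (suc N)) * detCols (A ∘ suc) (punchIn (fromℕ (suc N))))
  det-expand-last-column A = trans (∑-init-last (λ j → sgn R j * (A zero j * detCols (A ∘ suc) (punchIn j))))
    (+-congʳ (∑-cong λ j → *-congʳ {A zero (inject₁ j) * detCols (A ∘ suc) (punchIn (inject₁ j))}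
                                    (reflexive (sgn-inject₁ j))))

  det-rotate-columns : ∀ {N} (A : Matrix (suc N) (suc N)) →
                       det R (suc N) (λ a b → A a (rotate b)) ≈ sgn R (fromℕ N) * det R (suc N) A
  det-rotate-columns {zero}  A = sym (*-identityˡ _)
  det-rotate-columns {suc N} A = begin
    1# * (a * detCols (A ∘ suc) inject₁)
    + ∑ R _ (λ j → - sgn R j * (A zero (inject₁ j) * detCols (A ∘ suc) (rotate ∘ punchIn (suc j))))
      ≈⟨ +-cong first-term (∑-cong later-term) ⟩
    a * mₗ + ∑ R _ (λ j → - σ * (sgn R j * (A zero (inject₁ j) * m (inject₁ j))))
      ≈⟨ +-congˡ (*-distribˡ-∑ (- σ) (λ j → sgn R j * (A zero (inject₁ j) * m (inject₁ j)))) ⟨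
    a * mₗ + - σ * S
      ≈⟨ expand-det ⟨
    - σ * det R _ A ∎
    where
    σ = sgn R (fromℕ N)
    a = A zero (fromℕ (suc N))
    m = detCols (A ∘ suc) ∘ punchIn
    mₗ = m (fromℕ (suc N))
    S = ∑ R _ (λ j → sgn R j * (A zero (inject₁ j) * m (inject₁ j)))
    first-term : 1# * (a * detCols (A ∘ suc) inject₁) ≈ a * mₗ
    first-term = trans (*-identityˡ _) (*-congˡ (detCols-cong (A ∘ suc) (≡.sym ∘ punchIn-fromℕ)))
    exchange-sign : ∀ x y z w → - x * (y * (z * w)) ≈ - z * (x * (y * w))
    exchange-sign x y z w = begin
      - x * (y * (z * w))  ≈⟨ -‿distribˡ-* x _ ⟨
      - (x * (y * (z * w))) ≈⟨ -‿cong (solve 4 (λ x y z w → x :* (y :* (z :* w)) := z :* (x :* (y :* w))) refl x y z w) ⟩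
      - (z * (x * (y * w))) ≈⟨ -‿distribˡ-* z _ ⟩
      - z * (x * (y * w))  ∎
    later-term : ∀ j → - sgn R j * (A zero (inject₁ j) * detCols (A ∘ suc) (rotate ∘ punchIn (suc j)))
                       ≈ - σ * (sgn R j * (A zero (inject₁ j) * m (inject₁ j)))
    later-term j = begin
      - sgn R j * (A zero (inject₁ j) * detCols (A ∘ suc) (rotate ∘ punchIn (suc j)))
        ≈⟨ *-congˡ (*-congˡ (detCols-cong (A ∘ suc) (rotate-punchIn j))) ⟩
      - sgn R j * (A zero (inject₁ j) * det R _ (λ x b → A (suc x) (punchIn (inject₁ j) (rotate b))))
        ≈⟨ *-congˡ (*-congˡ (det-rotate-columns (λ x b → A (suc x) (punchIn (inject₁ j) b)))) ⟩
      - sgn R j * (A zero (inject₁ j) * (σ * m (inject₁ j)))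
        ≈⟨ exchange-sign (sgn R j) (A zero (inject₁ j)) σ (m (inject₁ j)) ⟩
      - σ * (sgn R j * (A zero (inject₁ j) * m (inject₁ j))) ∎
    expand-det : - σ * det R _ A ≈ a * mₗ + - σ * S
    expand-det = begin
      - σ * det R _ A                      ≈⟨ *-congˡ (det-expand-last-column A) ⟩
      - σ * (S + - σ * (a * mₗ))           ≈⟨ distribˡ (- σ) S _ ⟩
      - σ * S + - σ * (- σ * (a * mₗ))     ≈⟨ +-congˡ (*-assoc _ _ _) ⟨
      - σ * S + - σ * - σ * (a * mₗ)       ≈⟨ +-congˡ (trans (*-congʳ (sgn*sgn≈1 (fromℕ (suc N)))) (*-identityˡ _)) ⟩
      - σ * S + a * mₗ                     ≈⟨ +-comm _ _ ⟩
      a * mₗ + - σ * S                     ∎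

  det-first≈last-column≈0 : ∀ {N} (A : Matrix (suc (suc N)) (suc (suc N))) →
                            (∀ a → A a zero ≈ A a (fromℕ (suc N))) → det R (suc (suc N)) A ≈ 0#
  det-first≈last-column≈0 {N} A A₀≈Aₗ = begin
    det R _ A                                ≈⟨ *-identityˡ _ ⟨
    1# * det R _ A                           ≈⟨ *-congʳ (sgn*sgn≈1 (fromℕ (suc N))) ⟨
    σ * σ * det R _ A                        ≈⟨ *-assoc σ σ _ ⟩
    σ * (σ * det R _ A)                      ≈⟨ *-congˡ (det-rotate-columns A) ⟨
    σ * det R _ (λ a b → A a (rotate b))     ≈⟨ *-congˡ (det-equal-first-columns≈0 (λ a b → A a (rotate b)) (sym ∘ A₀≈Aₗ)) ⟩
    σ * 0#                                   ≈⟨ zeroʳ σ ⟩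
    0#                                       ∎
    where σ = sgn R (fromℕ (suc N))

  det-expand-snoc-column : ∀ {n N} (Q : Matrix (suc (suc N)) n) (cs : Fin (suc N) → Fin n) (p : Fin n) →
    detCols Q (snoc cs p) ≈
      ∑ R (suc N) (λ j → sgn R j * (Q zero (cs j) * detCols (Q ∘ suc) (snoc (cs ∘ punchIn j) p)))
      + sgn R (fromℕ (suc N)) * (Q zero p * detCols (Q ∘ suc) cs)
  det-expand-snoc-column Q cs p = trans (det-expand-last-column (λ a b → Q a (snoc cs p b))) (+-cong
    (∑-cong λ j → *-congˡ {sgn R j} (*-cong (reflexive (≡.cong (Q zero) (snoc-inject₁ cs p j)))
                                   (detCols-cong (Q ∘ suc) (snoc-punchIn-inject₁ cs p j))))
    (*-congˡ (*-cong (reflexive (≡.cong (Q zero) (snoc-fromℕ cs p)))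
                     (detCols-cong (Q ∘ suc) λ b → ≡.trans (≡.cong (snoc cs p) (punchIn-fromℕ b)) (snoc-inject₁ cs p b)))))

  -- The bordered expansion

  -- Q has the rows r₁ R, and y lists the columns of R, ending with p.
  module BorderedExpansion {n N : ℕ} (Q : Matrix (suc (suc N)) n) (cs y : Fin (suc N) → Fin n) where

    P : Matrix (suc N) n
    P = Q ∘ suc

    x : Fin n → Carrier
    x = Q zero

    p : Fin n
    p = y (fromℕ N)

    D C σ : Carrier
    D = detCols P y
    C = detCols P cs
    σ = sgn R (fromℕ (suc N))

    ψ : Fin (suc N) → Fin n → Carrier
    ψ s w = detCols P (cons w (y ∘ punchIn s))

    E : Fin (suc N) → Carrier
    E j = detCols P (snoc (cs ∘ punchIn j) p)

    bordered : Fin n → Carrier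
    bordered w = detCols Q (cons w y)

    bordered-expand : ∀ w → bordered w ≈ x w * D + ∑ R (suc N) (λ s → - sgn R s * (x (y s) * ψ s w))
    bordered-expand w = +-cong (*-identityˡ (x w * D)) (∑-cong λ s → *-congˡ { - sgn R s} (*-congˡ {x (y s)}
      (detCols-cong P {cons w y ∘ punchIn (suc s)} {cons w (y ∘ punchIn s)} λ { zero → ≡.refl ; (suc b) → ≡.refl })))

    ∑-bordered-p : ∑ R (suc N) (λ s → sgn R s * (x (y s) * ψ s p)) ≈ x p * D
    ∑-bordered-p = begin
      ∑ R _ (λ s → sgn R s * t s)        ≈⟨ -‿involutive _ ⟨
      - - ∑ R _ (λ s → sgn R s * t s)    ≈⟨ -‿cong (-‿distrib-∑ (λ s → sgn R s * t s)) ⟩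
      - ∑ R _ (λ s → - (sgn R s * t s))  ≈⟨ -‿cong (∑-cong λ s → -‿distribˡ-* (sgn R s) (t s)) ⟩
      - ∑ R _ (λ s → - sgn R s * t s)    ≈⟨ -‿cong (+-inverseʳ-unique _ _ (trans (sym (bordered-expand p)) bordered-p≈0)) ⟩
      - - (x p * D)                      ≈⟨ -‿involutive _ ⟩
      x p * D                            ∎
      where
      t : Fin (suc N) → Carrier
      t s = x (y s) * ψ s p
      bordered-p≈0 : bordered p ≈ 0#
      bordered-p≈0 = det-first≈last-column≈0 (λ a b → Q a (cons p y b)) (λ _ → refl)

    ψ-in-rowSpan : ∀ s → Σ (Fin (suc N) → Carrier) λ μ → ∀ w → ψ s w ≈ ∑ R (suc N) (λ t → P t w * μ t)
    ψ-in-rowSpan s = μ , λ w → trans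
        (det-cong {A = λ a b → P a (cons w (y ∘ punchIn s) b)} {B = λ a → cons (P a w) (Z a)}
                  λ { a zero → refl ; a (suc b) → refl })
        (proj₂ (firstColumn-cofactors Z) (λ a → P a w))
      where
      Z : Matrix (suc N) N
      Z a u = P a (y (punchIn s u))
      μ = proj₁ (firstColumn-cofactors Z)

    ψ-cofactor-sum : ∀ s → ∑ R (suc N) (λ j → sgn R j * (ψ s (cs j) * E j)) + σ * (ψ s p * C) ≈ 0#
    ψ-cofactor-sum s = begin
      ∑ R _ (λ j → sgn R j * (ψ s (cs j) * E j)) + σ * (ψ s p * C)
        ≈⟨ det-expand-snoc-column (cons (ψ s) P) cs p ⟨
      detCols (cons (ψ s) P) (snoc cs p)
        ≈⟨ det-cong {A = λ a b → cons (ψ s) P a (snoc cs p b)} {B = cons (ψ s ∘ snoc cs p) Pₛ}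
                    (λ { zero b → refl ; (suc a) b → refl }) ⟩
      det R _ (cons (ψ s ∘ snoc cs p) Pₛ)
        ≈⟨ det-firstRow-in-rowSpan≈0 Pₛ μ (ψ s ∘ snoc cs p) (λ b → proj₂ (ψ-in-rowSpan s) (snoc cs p b)) ⟩
      0# ∎
      where
      Pₛ : Matrix (suc N) (suc (suc N))
      Pₛ a b = P a (snoc cs p b)
      μ = proj₁ (ψ-in-rowSpan s)

    ∑-cross-terms : ∑ R (suc N) (λ s → - sgn R s * (x (y s) * ∑ R (suc N) (λ j → sgn R j * (ψ s (cs j) * E j))))
                  ≈ x p * D * (σ * C)
    ∑-cross-terms = begin
      ∑ R _ (λ s → - sgn R s * (x (y s) * ∑ R _ (λ j → sgn R j * (ψ s (cs j) * E j))))
        ≈⟨ ∑-cong (λ s → *-congˡ { - sgn R s} (*-congˡ {x (y s)} (+-inverseˡ-unique _ _ (ψ-cofactor-sum s)))) ⟩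
      ∑ R _ (λ s → - sgn R s * (x (y s) * - (σ * (ψ s p * C))))
        ≈⟨ ∑-cong (λ s → regroup (sgn R s) (x (y s)) σ (ψ s p) C) ⟩
      ∑ R _ (λ s → sgn R s * (x (y s) * ψ s p) * (σ * C))
        ≈⟨ *-distribʳ-∑ (σ * C) (λ s → sgn R s * (x (y s) * ψ s p)) ⟨
      ∑ R _ (λ s → sgn R s * (x (y s) * ψ s p)) * (σ * C)
        ≈⟨ *-congʳ ∑-bordered-p ⟩
      x p * D * (σ * C) ∎
      where
      regroup : ∀ a b c d e → - a * (b * - (c * (d * e))) ≈ a * (b * d) * (c * e)
      regroup a b c d e = begin
        - a * (b * - (c * (d * e)))  ≈⟨ *-congˡ (-‿distribʳ-* b _) ⟨
        - a * - (b * (c * (d * e)))  ≈⟨ -x*-y≈x*y a _ ⟩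
        a * (b * (c * (d * e)))      ≈⟨ solve 5 (λ a b c d e → a :* (b :* (c :* (d :* e))) := a :* (b :* d) :* (c :* e))
                                                refl a b c d e ⟩
        a * (b * d) * (c * e)        ∎

    ∑-bordered-split : ∑ R (suc N) (λ j → sgn R j * (bordered (cs j) * E j)) ≈
               D * ∑ R (suc N) (λ j → sgn R j * (x (cs j) * E j))
               + ∑ R (suc N) (λ s → - sgn R s * (x (y s) * ∑ R (suc N) (λ j → sgn R j * (ψ s (cs j) * E j))))
    ∑-bordered-split = begin
      ∑ R _ (λ j → sgn R j * (bordered (cs j) * E j))
        ≈⟨ ∑-cong (λ j → *-congˡ {sgn R j} (*-congʳ {E j} (bordered-expand (cs j)))) ⟩
      ∑ R _ (λ j → sgn R j * ((x (cs j) * D + ∑ R _ (λ s → f s j)) * E j))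
        ≈⟨ ∑-cong (λ j → split (sgn R j) (x (cs j)) D (∑ R _ (λ s → f s j)) (E j)) ⟩
      ∑ R _ (λ j → D * (sgn R j * (x (cs j) * E j)) + sgn R j * (∑ R _ (λ s → f s j) * E j))
        ≈⟨ ∑-distrib-+ (λ j → D * (sgn R j * (x (cs j) * E j))) (λ j → sgn R j * (∑ R _ (λ s → f s j) * E j)) ⟩
      ∑ R _ (λ j → D * (sgn R j * (x (cs j) * E j))) + ∑ R _ (λ j → sgn R j * (∑ R _ (λ s → f s j) * E j))
        ≈⟨ +-cong (sym (*-distribˡ-∑ D (λ j → sgn R j * (x (cs j) * E j)))) swap-sums ⟩
      D * ∑ R _ (λ j → sgn R j * (x (cs j) * E j))
      + ∑ R _ (λ s → - sgn R s * (x (y s) * ∑ R _ (λ j → sgn R j * (ψ s (cs j) * E j)))) ∎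
      where
      f : Fin (suc N) → Fin (suc N) → Carrier
      f s j = - sgn R s * (x (y s) * ψ s (cs j))
      split : ∀ g a d S e → g * ((a * d + S) * e) ≈ d * (g * (a * e)) + g * (S * e)
      split = solve 5 (λ g a d S e → g :* ((a :* d :+ S) :* e) := d :* (g :* (a :* e)) :+ g :* (S :* e)) refl
      swap-sums : ∑ R _ (λ j → sgn R j * (∑ R _ (λ s → f s j) * E j)) ≈
                  ∑ R _ (λ s → - sgn R s * (x (y s) * ∑ R _ (λ j → sgn R j * (ψ s (cs j) * E j))))
      swap-sums = begin
        ∑ R _ (λ j → sgn R j * (∑ R _ (λ s → f s j) * E j))
          ≈⟨ ∑-cong (λ j → trans (*-congˡ (*-distribʳ-∑ (E j) (λ s → f s j)))
                                 (*-distribˡ-∑ (sgn R j) (λ s → f s j * E j))) ⟩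
        ∑ R _ (λ j → ∑ R _ (λ s → sgn R j * (f s j * E j)))
          ≈⟨ ∑-comm (λ j s → sgn R j * (f s j * E j)) ⟩
        ∑ R _ (λ s → ∑ R _ (λ j → sgn R j * (f s j * E j)))
          ≈⟨ ∑-cong (λ s → ∑-cong (λ j → regroup (sgn R j) (- sgn R s) (x (y s)) (ψ s (cs j)) (E j))) ⟩
        ∑ R _ (λ s → ∑ R _ (λ j → - sgn R s * (x (y s) * (sgn R j * (ψ s (cs j) * E j)))))
          ≈⟨ ∑-cong (λ s → trans (sym (*-distribˡ-∑ (- sgn R s) (λ j → x (y s) * (sgn R j * (ψ s (cs j) * E j)))))
                                 (*-congˡ (sym (*-distribˡ-∑ (x (y s)) (λ j → sgn R j * (ψ s (cs j) * E j)))))) ⟩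
        ∑ R _ (λ s → - sgn R s * (x (y s) * ∑ R _ (λ j → sgn R j * (ψ s (cs j) * E j)))) ∎
        where
        regroup : ∀ g a b c e → g * (a * (b * c) * e) ≈ a * (b * (g * (c * e)))
        regroup = solve 5 (λ g a b c e → g :* (a :* (b :* c) :* e) := a :* (b :* (g :* (c :* e)))) refl

    bordered-cofactor-expansion : ∑ R (suc N) (λ j → sgn R j * (bordered (cs j) * E j)) ≈ detCols Q (snoc cs p) * D
    bordered-cofactor-expansion = begin
      ∑ R _ (λ j → sgn R j * (bordered (cs j) * E j))
        ≈⟨ ∑-bordered-split ⟩
      D * Σx + ∑ R _ (λ s → - sgn R s * (x (y s) * ∑ R _ (λ j → sgn R j * (ψ s (cs j) * E j))))
        ≈⟨ +-congˡ ∑-cross-terms ⟩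
      D * Σx + x p * D * (σ * C)
        ≈⟨ solve 5 (λ d S s a c → d :* S :+ a :* d :* (s :* c) := (S :+ s :* (a :* c)) :* d) refl D Σx σ (x p) C ⟩
      (Σx + σ * (x p * C)) * D
        ≈⟨ *-congʳ (det-expand-snoc-column Q cs p) ⟨
      detCols Q (snoc cs p) * D ∎
      where
      Σx = ∑ R (suc N) (λ j → sgn R j * (x (cs j) * E j))

  -- With 0-based indices, borderedMinor M r rc i w = M(rᵢ rᵢ₊₁ … r_K; w rcᵢ₊₁ … rc_K)
  -- and principalMinor M r rc t = M(r_t … r_K; rc_t … rc_K).
  borderedMinor : ∀ {m n K} → Matrix m n → (Fin (suc K) → Fin m) → (Fin (suc K) → Fin n) → Fin K → Fin n → Carrier
  borderedMinor {K = K} M r rc i w =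
    minor R M (suc (suc K ∸ toℕ (suc i))) (cons (r (inject₁ i)) (r ∘ idx (suc i))) (cons w (rc ∘ idx (suc i)))

  principalMinor : ∀ {m n K} → Matrix m n → (Fin (suc K) → Fin m) → (Fin (suc K) → Fin n) → Fin (suc K) → Carrier
  principalMinor {K = K} M r rc t = minor R M (suc K ∸ toℕ t) (r ∘ idx t) (rc ∘ idx t)

  sylvester-identity : ∀ {m n} k (M : Matrix m n) (r : Fin (suc (suc k)) → Fin m) (rc : Fin (suc (suc k)) → Fin n)
                       (cs : Fin (suc k) → Fin n) →
                       det R (suc k) (λ i j → borderedMinor M r rc i (cs j)) ≈
                       minor R M (suc (suc k)) r (snoc cs (rc (fromℕ (suc k))))
                       * ∏ R k (principalMinor M r rc ∘ suc ∘ inject₁)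
  sylvester-identity zero M r rc cs = trans (+-identityʳ _) (trans (*-identityˡ _) (*-congʳ
    (det-cong {A = λ a b → M (cons (r zero) (r ∘ suc) a) (cons (cs zero) (rc ∘ suc) b)}
              {B = λ a b → M (r a) (snoc cs (rc (fromℕ 1)) b)}
              λ { zero zero → refl ; zero (suc zero) → refl ; (suc zero) zero → refl ; (suc zero) (suc zero) → refl })))
  sylvester-identity {n = n} (suc k) M r rc cs = begin
    ∑ R _ (λ j → sgn R j * (bordered (cs j) * det R (suc k) (λ a b → borderedMinor M r rc (suc a) (cs (punchIn j b)))))
      ≈⟨ ∑-cong (λ j → *-congˡ {sgn R j} (*-congˡ {bordered (cs j)}
                         (sylvester-identity k M (r ∘ suc) (rc ∘ suc) (cs ∘ punchIn j)))) ⟩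
    ∑ R _ (λ j → sgn R j * (bordered (cs j) * (E j * Π)))
      ≈⟨ ∑-cong (λ j → regroup (sgn R j) (bordered (cs j)) (E j) Π) ⟩
    ∑ R _ (λ j → sgn R j * (bordered (cs j) * E j) * Π)
      ≈⟨ *-distribʳ-∑ Π (λ j → sgn R j * (bordered (cs j) * E j)) ⟨
    ∑ R _ (λ j → sgn R j * (bordered (cs j) * E j)) * Π
      ≈⟨ *-congʳ bordered-cofactor-expansion ⟩
    detCols Q (snoc cs p) * D * Π
      ≈⟨ *-assoc _ D Π ⟩
    detCols Q (snoc cs p) * (D * Π)
      ≈⟨ *-congʳ (det-cong {A = λ a b → Q a (snoc cs p b)} {B = λ a b → M (r a) (snoc cs p b)}
                           λ { zero b → refl ; (suc a) b → refl }) ⟩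
    minor R M _ r (snoc cs p) * (D * Π) ∎
    where
    Q : Matrix (suc (suc (suc k))) n
    Q a = M (cons (r zero) (r ∘ suc) a)
    open BorderedExpansion Q cs (rc ∘ suc)
    Π : Carrier
    Π = ∏ R k (λ t → principalMinor M r rc (suc (inject₁ (suc t))))
    regroup : ∀ g a e π → g * (a * (e * π)) ≈ g * (a * e) * π
    regroup = solve 4 (λ g a e π → g :* (a :* (e :* π)) := g :* (a :* e) :* π) refl

mainTheorem6 : {c ℓ : Level} (F : CommutativeRing c ℓ) → IsField F →
  let open CommutativeRing F renaming (zero to zeroR) in
  (m n k : ℕ) (M : Fin m → Fin n → Carrier)
  (r : Fin (suc (suc k)) → Fin m) (cs : Fin (suc k) → Fin n)
  (r<n : ∀ i → toℕ (r i) < n) →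
  let rc = λ i → fromℕ< (r<n i) in
  det F (suc k) (λ i j →
      minor F M (suc (suc (suc k) ∸ toℕ (suc i)))
        (cons (r (inject₁ i)) (λ t → r (idx (suc i) t)))
        (cons (cs j) (λ t → rc (idx (suc i) t))))
  ≈ (minor F M (suc (suc k)) r (snoc cs (rc (Data.Fin.fromℕ (suc k))))
     * ∏ F k (λ t → minor F M (suc (suc k) ∸ toℕ (suc (inject₁ t)))
                      (λ a → r (idx (suc (inject₁ t)) a))
                      (λ a → rc (idx (suc (inject₁ t)) a))))
mainTheorem6 F _ m n k M r cs r<n = Determinant.sylvester-identity F k M r (λ i → fromℕ< (r<n i)) cs
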